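{- Let $\mathbf{A}=(A,\circ)$ be a linear quasigroup with arithmetic form $(A,+,\varphi_0,\varphi_1,0)$, i.e. $x\circ y=\varphi_0(x)+\varphi_1(y)$ where $(A,+)$ is a (not necessarily abelian) group and $\varphi_0,\varphi_1$ are automorphisms of $(A,+)$. Let $t,t'\in B_n$ with corresponding binary trees $T,T'\in\mathcal{T}_n$. Then (i) $t^{\mathbf{A}}(a_1,\dots,a_n)=\varphi_{\mathrm{addr}_T(1)}(a_1)+\varphi_{\mathrm{addr}_T(2)}(a_2)+\dots+\varphi_{\mathrm{addr}_T(n)}(a_n)$ for all $a_1,\dots,a_n\in A$; (ii) $\mathbf{A}$ satisfies $t\approx t'$ if and only if $\varphi_{\mathrm{addr}_T(i)}=\varphi_{\mathrm{addr}_{T'}(i)}$ for all $i\in\{1,\dots,n\}$.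
   Context: A bracketing of size $n$ is a groupoid term obtained from $x_1\cdots x_n$ by inserting parentheses to form a fully parenthesised binary product; $B_n$ is their set, and $t^{\mathbf{A}}$ is the induced term operation. $\mathcal{T}_n$ is the set of binary trees (rooted plane trees where each internal vertex has an ordered left and right child) with $n$ leaves, numbered $1,\dots,n$ left to right; the tree of a bracketing is given by $\tau(x_i)=$ one-vertex tree, $\tau((t_1t_2))=$ tree whose root has left subtree $\tau(t_1)$ and right subtree $\tau(t_2)$. The address $\mathrm{addr}_T(v)$ is the word over $\{0,1\}$ recording the path from the root to $v$ ($0$ = left, $1$ = right). For a word $w$ over $\{0,1\}$: $\varphi_\varepsilon=\mathrm{id}_A$ and $\varphi_{iw}=\varphi_i\circ\varphi_w$ ($i\in\{0,1\}$). -}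

module Defs where

open import Level using (Level; _⊔_)
open import Data.Nat using (ℕ; zero; suc; _+_)
open import Data.Bool using (Bool; true; false)
open import Data.Fin using (Fin; splitAt; cast)
open import Data.Sum using (inj₁; inj₂)
open import Data.Product using (Σ; _,_)
open import Data.List using (List; []; _∷_; _++_; [_]; length; allFin; foldr)
open import Data.List.Properties using (length-++; length-tabulate)
open import Relation.Binary.PropositionalEquality
  using (_≡_; refl; sym; trans; cong; cong₂)
open import Algebra.Bundles using (Group)
open import Algebra.Morphism.Structures using (module GroupMorphisms)

-- Groupoid terms over the variables x₁ … xₙ (variable xᵢ is  var i,
-- with i : Fin n, Fin index 0 standing for x₁).

data Term (n : ℕ) : Set where
  var : Fin n → Term n
  _·_ : Term n → Term n → Term n

vars : ∀ {n} → Term n → List (Fin n)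
vars (var i) = [ i ]
vars (t · u) = vars t ++ vars u

-- Bracketings of size n: terms whose left-to-right variable sequence is
-- exactly x₁ x₂ … xₙ  (i.e. obtained from x₁⋯xₙ by inserting parentheses).
B : ℕ → Set
B n = Σ (Term n) (λ t → vars t ≡ allFin n)

data Tree : Set where
  leaf : Tree
  node : Tree → Tree → Tree

τ : ∀ {n} → Term n → Tree
τ (var i) = leaf
τ (t · u) = node (τ t) (τ u)

leaves : Tree → ℕ
leaves leaf = 1
leaves (node l r) = leaves l + leaves r

-- Words over {0,1}: false = 0 (left), true = 1 (right)
Word : Set
Word = List Bool

-- addr_T(i) for the i-th leaf of T (leaves numbered left to right from 0)
addr : (T : Tree) → Fin (leaves T) → Word
addr leaf _ = []
addr (node l r) i with splitAt (leaves l) i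
... | inj₁ j = false ∷ addr l j
... | inj₂ j = true ∷ addr r j

leaves-τ : ∀ {n} (t : Term n) → leaves (τ t) ≡ length (vars t)
leaves-τ (var i) = refl
leaves-τ (t · u) = trans (cong₂ _+_ (leaves-τ t) (leaves-τ u))
                         (sym (length-++ (vars t)))

leaves-B : ∀ {n} (b : B n) → leaves (τ (Σ.proj₁ b)) ≡ n
leaves-B (t , p) = trans (leaves-τ t)
                   (trans (cong length p) (length-tabulate (λ i → i)))

addrB : ∀ {n} (b : B n) → Fin n → Word
addrB b i = addr (τ (Σ.proj₁ b)) (cast (sym (leaves-B b)) i)

module _ {c ℓ : Level} (G : Group c ℓ) where
  open Group G

  IsAutomorphism : (Carrier → Carrier) → Set (c ⊔ ℓ)
  IsAutomorphism φ = GroupMorphisms.IsGroupIsomorphism rawGroup rawGroup φ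

  linOp : (Carrier → Carrier) → (Carrier → Carrier) → Carrier → Carrier → Carrier
  linOp φ₀ φ₁ x y = φ₀ x ∙ φ₁ y

  eval : ∀ {n} → (Carrier → Carrier → Carrier) → Term n → (Fin n → Carrier) → Carrier
  eval op (var i) a = a i
  eval op (t · u) a = op (eval op t a) (eval op u a)

  φw : (Carrier → Carrier) → (Carrier → Carrier) → Word → Carrier → Carrier
  φw φ₀ φ₁ [] x = x
  φw φ₀ φ₁ (false ∷ w) x = φ₀ (φw φ₀ φ₁ w x)
  φw φ₀ φ₁ (true ∷ w) x = φ₁ (φw φ₀ φ₁ w x)

  sumFin : ∀ n → (Fin n → Carrier) → Carrier
  sumFin n f = foldr (λ i acc → f i ∙ acc) ε (allFin n)

-- Since φ₀ and φ₁ are monoid endomorphisms of (A,+), induction on the term shows that they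
-- distribute over the sums computed for the two subterms, prefixing 0 resp. 1 to the address of
-- every leaf.  Part (ii) follows by evaluating both sides at the assignment that is x at
-- position i and 0 elsewhere, which isolates the single summand φ_{addr(i)}(x).
module Submission where

open import Defs
open import Level using (Level)
open import Data.Nat using (ℕ; zero; suc; _+_)
open import Data.Fin using (Fin; zero; suc; _↑ˡ_; _↑ʳ_; cast)
open import Data.Fin.Properties using (splitAt-↑ˡ; splitAt-↑ʳ; cast-is-id; suc-injective)
open import Data.Bool using (Bool; false; true)
open import Data.Product using (_×_; _,_; proj₁; proj₂; map₁; <_,_>)
open import Data.List using (List; []; _∷_; _++_; [_]; map; foldr; tabulate; allFin)
open import Data.List.Properties
  using (map-∘; map-++; map-tabulate; tabulate-cong; foldr-map; ∷-injective)
open import Data.Vec.Functional using (updateAt; replicate)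
open import Data.Vec.Functional.Properties using (updateAt-updates; updateAt-minimal)
open import Function using (_∘_; id; const; _⇔_; mk⇔)
open import Algebra.Bundles using (Monoid; Group)
open import Algebra.Morphism.Structures using (module MonoidMorphisms; module GroupMorphisms)
import Algebra.Morphism.Construct.Identity as Identity
import Algebra.Morphism.Construct.Composition as Composition
open import Relation.Binary.PropositionalEquality as ≡ using (_≡_; _≢_)
import Relation.Binary.Reasoning.Setoid as SetoidReasoning

tabulate-↑ˡ-++-↑ʳ : ∀ {a} {A : Set a} m n (f : Fin (m + n) → A) →
  tabulate f ≡ tabulate (f ∘ (_↑ˡ n)) ++ tabulate (f ∘ (m ↑ʳ_))
tabulate-↑ˡ-++-↑ʳ zero    n f = ≡.refl
tabulate-↑ˡ-++-↑ʳ (suc m) n f = ≡.cong (f zero ∷_) (tabulate-↑ˡ-++-↑ʳ m n (f ∘ suc))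

tabulate-cast : ∀ {a} {A : Set a} {m n} (p : m ≡ n) (f : Fin m → A) →
  tabulate (f ∘ cast (≡.sym p)) ≡ tabulate f
tabulate-cast ≡.refl f = tabulate-cong (≡.cong f ∘ cast-is-id ≡.refl)

map-proj₁-proj₂-injective : ∀ {a b} {A : Set a} {B : Set b} (xs ys : List (A × B)) →
  map proj₁ xs ≡ map proj₁ ys → map proj₂ xs ≡ map proj₂ ys → xs ≡ ys
map-proj₁-proj₂-injective []       []       _ _ = ≡.refl
map-proj₁-proj₂-injective (x ∷ xs) (y ∷ ys) p q
  with ∷-injective p | ∷-injective q
... | x₁≡y₁ , p′ | x₂≡y₂ , q′ =
  ≡.cong₂ _∷_ (≡.cong₂ _,_ x₁≡y₁ x₂≡y₂) (map-proj₁-proj₂-injective xs ys p′ q′)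

module MonoidSum {c ℓ : Level} (M : Monoid c ℓ) where
  open Monoid M
  open MonoidMorphisms rawMonoid rawMonoid using (IsMonoidHomomorphism)

  sum : List Carrier → Carrier
  sum = foldr _∙_ ε

  sum-++ : ∀ xs ys → sum (xs ++ ys) ≈ sum xs ∙ sum ys
  sum-++ []       ys = sym (identityˡ _)
  sum-++ (x ∷ xs) ys = trans (∙-congˡ (sum-++ xs ys)) (sym (assoc _ _ _))

  sum-homo : ∀ {f} → IsMonoidHomomorphism f → ∀ xs → f (sum xs) ≈ sum (map f xs)
  sum-homo h []       = IsMonoidHomomorphism.ε-homo h
  sum-homo h (x ∷ xs) =
    trans (IsMonoidHomomorphism.homo h _ _) (∙-congˡ (sum-homo h xs))

  sum-tabulate-cong : ∀ {n} {f g : Fin n → Carrier} →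
    (∀ i → f i ≈ g i) → sum (tabulate f) ≈ sum (tabulate g)
  sum-tabulate-cong {zero}  f≈g = refl
  sum-tabulate-cong {suc n} f≈g = ∙-cong (f≈g zero) (sum-tabulate-cong (f≈g ∘ suc))

  sum-tabulate-ε : ∀ {n} {f : Fin n → Carrier} → (∀ i → f i ≈ ε) → sum (tabulate f) ≈ ε
  sum-tabulate-ε {zero}  f≈ε = refl
  sum-tabulate-ε {suc n} f≈ε =
    trans (∙-cong (f≈ε zero) (sum-tabulate-ε (f≈ε ∘ suc))) (identityˡ ε)

  sum-tabulate-single : ∀ {n} {f : Fin n → Carrier} (i : Fin n) →
    (∀ j → j ≢ i → f j ≈ ε) → sum (tabulate f) ≈ f i
  sum-tabulate-single zero    f≈ε =
    trans (∙-congˡ (sum-tabulate-ε (λ j → f≈ε (suc j) λ ()))) (identityʳ _)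
  sum-tabulate-single (suc i) f≈ε =
    trans (∙-cong (f≈ε zero λ ()) (sum-tabulate-single i λ j j≢i → f≈ε (suc j) (j≢i ∘ suc-injective)))
          (identityˡ _)

addr-↑ˡ : ∀ l r (i : Fin (leaves l)) → addr (node l r) (i ↑ˡ leaves r) ≡ false ∷ addr l i
addr-↑ˡ l r i rewrite splitAt-↑ˡ (leaves l) i (leaves r) = ≡.refl

addr-↑ʳ : ∀ l r (i : Fin (leaves r)) → addr (node l r) (leaves l ↑ʳ i) ≡ true ∷ addr r i
addr-↑ʳ l r i rewrite splitAt-↑ʳ (leaves l) (leaves r) i = ≡.refl

tabulate-addr-node : ∀ l r → tabulate (addr (node l r)) ≡
  map (false ∷_) (tabulate (addr l)) ++ map (true ∷_) (tabulate (addr r))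
tabulate-addr-node l r = ≡.trans (tabulate-↑ˡ-++-↑ʳ (leaves l) (leaves r) (addr (node l r)))
  (≡.cong₂ _++_
    (≡.trans (tabulate-cong (addr-↑ˡ l r)) (≡.sym (map-tabulate (addr l) (false ∷_))))
    (≡.trans (tabulate-cong (addr-↑ʳ l r)) (≡.sym (map-tabulate (addr r) (true ∷_)))))

occurrences : ∀ {n} → Term n → List (Word × Fin n)
occurrences (var i) = [ [] , i ]
occurrences (t · u) =
  map (map₁ (false ∷_)) (occurrences t) ++ map (map₁ (true ∷_)) (occurrences u)

map-proj₁-occurrences : ∀ {n} (t : Term n) → map proj₁ (occurrences t) ≡ tabulate (addr (τ t))
map-proj₁-occurrences (var i) = ≡.refl
map-proj₁-occurrences (t · u) = begin
  map proj₁ (map (map₁ (false ∷_)) (occurrences t) ++ map (map₁ (true ∷_)) (occurrences u))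
    ≡⟨ map-++ proj₁ (map (map₁ (false ∷_)) (occurrences t)) _ ⟩
  map proj₁ (map (map₁ (false ∷_)) (occurrences t)) ++ map proj₁ (map (map₁ (true ∷_)) (occurrences u))
    ≡⟨ ≡.cong₂ _++_ (prefix false t) (prefix true u) ⟩
  map (false ∷_) (tabulate (addr (τ t))) ++ map (true ∷_) (tabulate (addr (τ u)))
    ≡⟨ tabulate-addr-node (τ t) (τ u) ⟨
  tabulate (addr (τ (t · u))) ∎
  where
  open ≡.≡-Reasoning
  prefix : ∀ {m} (b : Bool) (t : Term m) → map proj₁ (map (map₁ (b ∷_)) (occurrences t)) ≡ map (b ∷_) (tabulate (addr (τ t)))
  prefix b t = ≡.trans (≡.sym (map-∘ (occurrences t)))
                       (≡.trans (map-∘ (occurrences t)) (≡.cong (map (b ∷_)) (map-proj₁-occurrences t)))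

map-proj₂-occurrences : ∀ {n} (t : Term n) → map proj₂ (occurrences t) ≡ vars t
map-proj₂-occurrences (var i) = ≡.refl
map-proj₂-occurrences (t · u) =
  ≡.trans (map-++ proj₂ (map (map₁ (false ∷_)) (occurrences t)) _)
          (≡.cong₂ _++_ (forget false t) (forget true u))
  where
  forget : ∀ {m} (b : Bool) (t : Term m) → map proj₂ (map (map₁ (b ∷_)) (occurrences t)) ≡ vars t
  forget b t = ≡.trans (≡.sym (map-∘ (occurrences t))) (map-proj₂-occurrences t)

occurrences-bracketing : ∀ {n} (b : B n) → occurrences (proj₁ b) ≡ tabulate < addrB b , id >
occurrences-bracketing b@(t , vars≡) = map-proj₁-proj₂-injective _ _
  (≡.trans (map-proj₁-occurrences t)
    (≡.trans (≡.sym (tabulate-cast (leaves-B b) (addr (τ t))))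
             (≡.sym (map-tabulate < addrB b , id > proj₁))))
  (≡.trans (map-proj₂-occurrences t)
    (≡.trans vars≡ (≡.sym (map-tabulate < addrB b , id > proj₂))))

module LinearGroupoid {c ℓ : Level} (G : Group c ℓ) where
  open Group G
  open MonoidSum monoid
  open MonoidMorphisms rawMonoid rawMonoid using (IsMonoidHomomorphism)
  open SetoidReasoning setoid

  sumFin≡sum-tabulate : ∀ n (f : Fin n → Carrier) → sumFin G n f ≡ sum (tabulate f)
  sumFin≡sum-tabulate n f =
    ≡.trans (≡.sym (foldr-map _∙_ f ε (allFin n))) (≡.cong sum (map-tabulate id f))

  module _ {φ₀ φ₁ : Carrier → Carrier}
           (φ₀-homo : IsMonoidHomomorphism φ₀) (φ₁-homo : IsMonoidHomomorphism φ₁) where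

    φ : Word → Carrier → Carrier
    φ = φw G φ₀ φ₁

    _∘ₐ_ : Carrier → Carrier → Carrier
    _∘ₐ_ = linOp G φ₀ φ₁

    φ-homo : ∀ w → IsMonoidHomomorphism (φ w)
    φ-homo []          = Identity.isMonoidHomomorphism rawMonoid refl
    φ-homo (false ∷ w) = Composition.isMonoidHomomorphism trans (φ-homo w) φ₀-homo
    φ-homo (true ∷ w)  = Composition.isMonoidHomomorphism trans (φ-homo w) φ₁-homo

    summand : ∀ {n} → (Fin n → Carrier) → Word × Fin n → Carrier
    summand a (w , i) = φ w (a i)

    summand-prefix : ∀ {n} (a : Fin n → Carrier) b xs →
      map (summand a) (map (map₁ (b ∷_)) xs) ≡ map (φ (b ∷ [])) (map (summand a) xs)
    summand-prefix a false xs = ≡.trans (≡.sym (map-∘ xs)) (map-∘ xs)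
    summand-prefix a true  xs = ≡.trans (≡.sym (map-∘ xs)) (map-∘ xs)

    eval-occurrences : ∀ {n} (t : Term n) a →
      eval G _∘ₐ_ t a ≈ sum (map (summand a) (occurrences t))
    eval-occurrences (var i) a = sym (identityʳ _)
    eval-occurrences (t · u) a = begin
      φ₀ (eval G _∘ₐ_ t a) ∙ φ₁ (eval G _∘ₐ_ u a)
        ≈⟨ ∙-cong (⟦⟧-cong φ₀-homo (eval-occurrences t a)) (⟦⟧-cong φ₁-homo (eval-occurrences u a)) ⟩
      φ₀ (sum ts) ∙ φ₁ (sum us)
        ≈⟨ ∙-cong (sum-homo φ₀-homo ts) (sum-homo φ₁-homo us) ⟩
      sum (map φ₀ ts) ∙ sum (map φ₁ us)
        ≈⟨ sum-++ (map φ₀ ts) (map φ₁ us) ⟨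
      sum (map φ₀ ts ++ map φ₁ us)
        ≡⟨ ≡.cong sum (≡.cong₂ _++_ (summand-prefix a false (occurrences t))
                                    (summand-prefix a true (occurrences u))) ⟨
      sum (map (summand a) (map (map₁ (false ∷_)) (occurrences t))
           ++ map (summand a) (map (map₁ (true ∷_)) (occurrences u)))
        ≡⟨ ≡.cong sum (map-++ (summand a) (map (map₁ (false ∷_)) (occurrences t)) _) ⟨
      sum (map (summand a) (occurrences (t · u))) ∎
      where
      ts = map (summand a) (occurrences t)
      us = map (summand a) (occurrences u)
      open IsMonoidHomomorphism using (⟦⟧-cong)

    eval-bracketing : ∀ {n} (b : B n) a →
      eval G _∘ₐ_ (proj₁ b) a ≈ sum (tabulate (λ i → φ (addrB b i) (a i)))
    eval-bracketing b a = begin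
      eval G _∘ₐ_ (proj₁ b) a                        ≈⟨ eval-occurrences (proj₁ b) a ⟩
      sum (map (summand a) (occurrences (proj₁ b)))  ≡⟨ ≡.cong (sum ∘ map (summand a)) (occurrences-bracketing b) ⟩
      sum (map (summand a) (tabulate < addrB b , id >)) ≡⟨ ≡.cong sum (map-tabulate < addrB b , id > (summand a)) ⟩
      sum (tabulate (λ i → φ (addrB b i) (a i)))     ∎

    point : ∀ {n} → Fin n → Carrier → Fin n → Carrier
    point {n} i x = updateAt (replicate n ε) i (const x)

    eval-bracketing-point : ∀ {n} (b : B n) i x → eval G _∘ₐ_ (proj₁ b) (point i x) ≈ φ (addrB b i) x
    eval-bracketing-point {n} b i x = begin
      eval G _∘ₐ_ (proj₁ b) (point i x)                       ≈⟨ eval-bracketing b (point i x) ⟩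
      sum (tabulate (λ j → φ (addrB b j) (point i x j)))      ≈⟨ sum-tabulate-single i vanishes ⟩
      φ (addrB b i) (point i x i)                             ≡⟨ ≡.cong (φ (addrB b i)) (updateAt-updates i (replicate n ε)) ⟩
      φ (addrB b i) x                                         ∎
      where
      vanishes : ∀ j → j ≢ i → φ (addrB b j) (point i x j) ≈ ε
      vanishes j j≢i = trans (IsMonoidHomomorphism.⟦⟧-cong (φ-homo (addrB b j))
                                (reflexive (updateAt-minimal j i (replicate n ε) j≢i)))
                             (IsMonoidHomomorphism.ε-homo (φ-homo (addrB b j)))

    identity⇔addresses : ∀ {n} (t t′ : B n) →
      (∀ a → eval G _∘ₐ_ (proj₁ t) a ≈ eval G _∘ₐ_ (proj₁ t′) a)
        ⇔ (∀ i x → φ (addrB t i) x ≈ φ (addrB t′ i) x)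
    identity⇔addresses t t′ = mk⇔
      (λ t≈t′ i x → begin
        φ (addrB t i) x                     ≈⟨ eval-bracketing-point t i x ⟨
        eval G _∘ₐ_ (proj₁ t) (point i x)   ≈⟨ t≈t′ (point i x) ⟩
        eval G _∘ₐ_ (proj₁ t′) (point i x)  ≈⟨ eval-bracketing-point t′ i x ⟩
        φ (addrB t′ i) x                    ∎)
      (λ φt≈φt′ a → begin
        eval G _∘ₐ_ (proj₁ t) a                          ≈⟨ eval-bracketing t a ⟩
        sum (tabulate (λ i → φ (addrB t i) (a i)))       ≈⟨ sum-tabulate-cong (λ i → φt≈φt′ i (a i)) ⟩
        sum (tabulate (λ i → φ (addrB t′ i) (a i)))      ≈⟨ eval-bracketing t′ a ⟨
        eval G _∘ₐ_ (proj₁ t′) a                         ∎)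

proposition4p1 : {c ℓ : Level} (G : Group c ℓ) →
    let open Group G in
    (φ₀ φ₁ : Carrier → Carrier) →
    IsAutomorphism G φ₀ → IsAutomorphism G φ₁ →
    (n : ℕ) (t t′ : B n) →
      ((a : Fin n → Carrier) →
         eval G (linOp G φ₀ φ₁) (proj₁ t) a
           ≈ sumFin G n (λ i → φw G φ₀ φ₁ (addrB t i) (a i)))
      ×
      (((a : Fin n → Carrier) →
          eval G (linOp G φ₀ φ₁) (proj₁ t) a ≈ eval G (linOp G φ₀ φ₁) (proj₁ t′) a)
        ⇔ ((i : Fin n) (x : Carrier) →
          φw G φ₀ φ₁ (addrB t i) x ≈ φw G φ₀ φ₁ (addrB t′ i) x))
proposition4p1 G φ₀ φ₁ φ₀-auto φ₁-auto n t t′ =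
  (λ a → Group.trans G (eval-bracketing φ₀-homo φ₁-homo t a)
           (Group.reflexive G (≡.sym (sumFin≡sum-tabulate n _))))
  , identity⇔addresses φ₀-homo φ₁-homo t t′
  where
  open LinearGroupoid G
  open GroupMorphisms.IsGroupIsomorphism φ₀-auto using () renaming (isMonoidHomomorphism to φ₀-homo)
  open GroupMorphisms.IsGroupIsomorphism φ₁-auto using () renaming (isMonoidHomomorphism to φ₁-homo)
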